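{- Let $G$ be a graph, $k\geq 1$ an integer, and $v$ a vertex of $G$. Suppose there is a matching $a_1b_1,\dots,a_nb_n$ of size $n\ge 4k+2$ in $G- v$ such that every $a_i$ is a neighbor of $v$. Then for every edge $e$ incident to $v$, the graph $G$ contains $k$ pairwise vertex-disjoint paths with $3$ edges each if and only if $G- e$ does.
   Context: $G-v$ denotes the graph obtained by deleting vertex $v$; $G-e$ denotes the graph obtained by deleting the edge $e$ (keeping its endpoints). -}

module Defs where

open import Data.Nat using (ℕ; suc; _+_; _*_; _≤_)
open import Data.Fin using (Fin; zero; suc)
open import Data.Product using (Σ; _×_; _,_)
open import Data.Sum using (_⊎_)
open import Relation.Nullary using (¬_)
open import Relation.Binary.PropositionalEquality using (_≡_; _≢_)

record Graph : Set₁ where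
  field
    V     : ℕ
    Adj   : Fin V → Fin V → Set
    sym   : ∀ {x y} → Adj x y → Adj y x
    irrefl : ∀ {x} → ¬ Adj x x
open Graph public

deleteEdge : (G : Graph) → Fin (V G) → Fin (V G) → Graph
deleteEdge G u w = record
  { V = V G
  ; Adj = λ x y → Adj G x y × ¬ ((x ≡ u × y ≡ w) ⊎ (x ≡ w × y ≡ u))
  ; sym = λ { (a , h) → sym G a , λ { (Data.Sum.inj₁ (p , q)) → h (Data.Sum.inj₂ (q , p))
                                    ; (Data.Sum.inj₂ (p , q)) → h (Data.Sum.inj₁ (q , p)) } }
  ; irrefl = λ { (a , _) → irrefl G a }
  }

HasDisjointP3s : (G : Graph) → ℕ → Set
HasDisjointP3s G k =
  Σ (Fin k → Fin 4 → Fin (V G)) λ p →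
    (∀ i j a b → p i a ≡ p j b → (i ≡ j × a ≡ b)) ×
    (∀ i → Adj G (p i zero) (p i (suc zero))
         × Adj G (p i (suc zero)) (p i (suc (suc zero)))
         × Adj G (p i (suc (suc zero))) (p i (suc (suc (suc zero)))))

NeighbourMatching : (G : Graph) → Fin (V G) → ℕ → Set
NeighbourMatching G v n =
  Σ (Fin n → Fin (V G)) λ a → Σ (Fin n → Fin (V G)) λ b →
    (∀ i j → a i ≡ a j → i ≡ j) ×
    (∀ i j → b i ≡ b j → i ≡ j) ×
    (∀ i j → a i ≢ b j) ×
    (∀ i → a i ≢ v × b i ≢ v) ×
    (∀ i → Adj G (a i) (b i)) ×
    (∀ i → Adj G v (a i))

-- Paths of G − vu are paths of G.  Conversely, k disjoint P₃'s of G survive in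
-- G − vu unless v lies on one of them, say P.  Their 4k vertices touch at most
-- 4k − 1 matching edges (each vertex at most one, v none), and at most one more
-- matching edge has aᵢ = u.  Since n ≥ 4k + 2, two matching edges aⱼbⱼ and aₗbₗ
-- are left over, and replacing P by bⱼ aⱼ v aₗ gives k disjoint P₃'s avoiding vu.
module Submission where

open import Defs
open import Data.Nat using (ℕ; suc; _≤_; _+_; _*_)
open import Data.Nat.Properties using (*-comm; +-comm)
open import Data.Fin using (Fin; zero; suc; combine)
open import Data.Fin.Properties using (_≟_; any?; pigeonhole; suc-injective; combine-injective; <⇒≢)
open import Data.Vec.Functional using (Vector; []; _∷_)
open import Data.Product using (_×_; _,_; proj₁; proj₂; ∃₂)
open import Data.Sum using (_⊎_; inj₁; inj₂)
open import Data.Empty using (⊥-elim)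
open import Function using (_∘_)
open import Level using (0ℓ)
open import Function.Bundles using (_⇔_; mk⇔)
open import Relation.Nullary using (¬_; Dec; yes; no)
open import Relation.Nullary.Decidable using (_⊎-dec_)
open import Relation.Unary using (Pred; Decidable)
open import Relation.Binary.PropositionalEquality
  using (_≡_; _≢_; refl; trans; subst) renaming (sym to ≡-sym)

private
  variable
    A : Set
    k n : ℕ

IsP3 : (G : Graph) → Vector (Fin (V G)) 4 → Set
IsP3 G q = Adj G (q zero) (q (suc zero))
         × Adj G (q (suc zero)) (q (suc (suc zero)))
         × Adj G (q (suc (suc zero))) (q (suc (suc (suc zero))))

Disjoint : (Fin k → Vector A 4) → Set
Disjoint p = ∀ i j a b → p i a ≡ p j b → i ≡ j × a ≡ b

Injective : Vector A n → Set
Injective xs = ∀ a b → xs a ≡ xs b → a ≡ b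

∷-injective : {x : A} {xs : Vector A n} →
              (∀ a → x ≢ xs a) → Injective xs → Injective (x ∷ xs)
∷-injective x∉xs xs-inj zero    zero    _  = refl
∷-injective x∉xs xs-inj zero    (suc b) eq = ⊥-elim (x∉xs b eq)
∷-injective x∉xs xs-inj (suc a) zero    eq = ⊥-elim (x∉xs a (≡-sym eq))
∷-injective x∉xs xs-inj (suc a) (suc b) eq with refl ← xs-inj a b eq = refl

distinct₄-injective : {x₀ x₁ x₂ x₃ : A} →
  x₀ ≢ x₁ → x₀ ≢ x₂ → x₀ ≢ x₃ → x₁ ≢ x₂ → x₁ ≢ x₃ → x₂ ≢ x₃ →
  Injective (x₀ ∷ x₁ ∷ x₂ ∷ x₃ ∷ [])
distinct₄-injective {x₁ = x₁} {x₂} {x₃} x₀≢x₁ x₀≢x₂ x₀≢x₃ x₁≢x₂ x₁≢x₃ x₂≢x₃ =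
  ∷-injective {xs = x₁ ∷ x₂ ∷ x₃ ∷ []}
    (λ { zero → x₀≢x₁ ; (suc zero) → x₀≢x₂ ; (suc (suc zero)) → x₀≢x₃ })
    (∷-injective {xs = x₂ ∷ x₃ ∷ []} (λ { zero → x₁≢x₂ ; (suc zero) → x₁≢x₃ })
      (∷-injective {xs = x₃ ∷ []} (λ { zero → x₂≢x₃ })
        (∷-injective {xs = []} (λ ()) (λ ()))))

_[_]≔_ : (Fin k → Vector A 4) → Fin k → Vector A 4 → Fin k → Vector A 4
(p [ i₀ ]≔ q) i with i ≟ i₀
... | yes _ = q
... | no  _ = p i

module _ {p : Fin k → Vector A 4} {i₀ : Fin k} {q : Vector A 4} where

  ≔-disjoint : Disjoint p → Injective q → (∀ a i b → q a ≡ p i b → i ≡ i₀) →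
               Disjoint (p [ i₀ ]≔ q)
  ≔-disjoint p-disj q-inj q-meets-only-i₀ i j a b eq with i ≟ i₀ | j ≟ i₀
  ... | yes i≡i₀ | yes j≡i₀ = trans i≡i₀ (≡-sym j≡i₀) , q-inj a b eq
  ... | yes _    | no  j≢i₀ = ⊥-elim (j≢i₀ (q-meets-only-i₀ a j b eq))
  ... | no  i≢i₀ | yes _    = ⊥-elim (i≢i₀ (q-meets-only-i₀ b i a (≡-sym eq)))
  ... | no  _    | no  _    = p-disj i j a b eq

≔-isP3 : {G : Graph} {p : Fin k → Vector (Fin (V G)) 4} {i₀ : Fin k}
         {q : Vector (Fin (V G)) 4} →
         (∀ i → i ≢ i₀ → IsP3 G (p i)) → IsP3 G q → ∀ i → IsP3 G ((p [ i₀ ]≔ q) i)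
≔-isP3 {i₀ = i₀} p-paths q-path i with i ≟ i₀
... | yes _    = q-path
... | no  i≢i₀ = p-paths i i≢i₀

module _ (G : Graph) (u w : Fin (V G)) where

  deleteEdge-avoiding : ∀ {x y} → Adj G x y → x ≢ u → y ≢ u → Adj (deleteEdge G u w) x y
  deleteEdge-avoiding xy x≢u y≢u =
    xy , λ { (inj₁ (x≡u , _)) → x≢u x≡u ; (inj₂ (_ , y≡u)) → y≢u y≡u }

  deleteEdge-keeps : ∀ {x y} → Adj G x y → x ≢ u → x ≢ w → Adj (deleteEdge G u w) x y
  deleteEdge-keeps xy x≢u x≢w =
    xy , λ { (inj₁ (x≡u , _)) → x≢u x≡u ; (inj₂ (x≡w , _)) → x≢w x≡w }

  isP3-deleteEdge : ∀ {q} → IsP3 G q → (∀ a → q a ≢ u) → IsP3 (deleteEdge G u w) q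
  isP3-deleteEdge (e₀ , e₁ , e₂) q≢u =
    deleteEdge-avoiding e₀ (q≢u _) (q≢u _) ,
    deleteEdge-avoiding e₁ (q≢u _) (q≢u _) ,
    deleteEdge-avoiding e₂ (q≢u _) (q≢u _)

  isP3-deleteEdge⁻ : ∀ {q} → IsP3 (deleteEdge G u w) q → IsP3 G q
  isP3-deleteEdge⁻ ((e₀ , _) , (e₁ , _) , (e₂ , _)) = e₀ , e₁ , e₂

module _ {n m : ℕ} {Bad : Pred (Fin n) 0ℓ} (bad? : Decidable Bad)
         (blame : ∀ {j} → Bad j → Fin m)
         (blame-injective : ∀ {j l} (bj : Bad j) (bl : Bad l) → blame bj ≡ blame bl → j ≡ l)
         where

  private
    label : ∀ {j} → Dec (Bad j) → Fin (suc m)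
    label (yes bj) = suc (blame bj)
    label (no _)   = zero

  two-unblamed : 2 + m ≤ n → ∃₂ λ j l → j ≢ l × ¬ Bad j × ¬ Bad l
  two-unblamed m<n with pigeonhole m<n (label ∘ bad?)
  ... | j , l , j<l , same-label with bad? j | bad? l
  ... | no ¬bj | no ¬bl = j , l , <⇒≢ j<l , ¬bj , ¬bl
  ... | yes bj | yes bl =
    ⊥-elim (<⇒≢ j<l (blame-injective bj bl (suc-injective same-label)))

module _ {G : Graph} {v u : Fin (V G)} {n : ℕ} {a b : Fin n → Fin (V G)}
         (a-inj : ∀ i j → a i ≡ a j → i ≡ j)
         (b-inj : ∀ i j → b i ≡ b j → i ≡ j)
         (a≢b : ∀ i j → a i ≢ b j)
         (a,b≢v : ∀ i → a i ≢ v × b i ≢ v)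
         (ab-adj : ∀ i → Adj G (a i) (b i))
         (va-adj : ∀ i → Adj G v (a i))
         {p : Fin k → Vector (Fin (V G)) 4} (p-disj : Disjoint p)
         where

  Touches : Fin (V G) → Fin n → Set
  Touches x j = x ≡ a j ⊎ x ≡ b j

  touches-unique : ∀ {x j l} → Touches x j → Touches x l → j ≡ l
  touches-unique {j = j} {l} (inj₁ refl) (inj₁ x≡aₗ) = a-inj j l x≡aₗ
  touches-unique {j = j} {l} (inj₁ refl) (inj₂ x≡bₗ) = ⊥-elim (a≢b j l x≡bₗ)
  touches-unique {j = j} {l} (inj₂ refl) (inj₁ x≡aₗ) = ⊥-elim (a≢b l j (≡-sym x≡aₗ))
  touches-unique {j = j} {l} (inj₂ refl) (inj₂ x≡bₗ) = b-inj j l x≡bₗ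

  Spoilt : Fin n → Set
  Spoilt j = (∃₂ λ i c → Touches (p i c) j) ⊎ a j ≡ u

  spoilt? : Decidable Spoilt
  spoilt? j = any? (λ i → any? (λ c → (p i c ≟ a j) ⊎-dec (p i c ≟ b j))) ⊎-dec (a j ≟ u)

  module _ {i₀ : Fin k} {c₀ : Fin 4} (p≡v : p i₀ c₀ ≡ v) where

    v-untouched : ∀ {j} → ¬ Touches (p i₀ c₀) j
    v-untouched {j} (inj₁ p≡aⱼ) = proj₁ (a,b≢v j) (trans (≡-sym p≡aⱼ) p≡v)
    v-untouched {j} (inj₂ p≡bⱼ) = proj₂ (a,b≢v j) (trans (≡-sym p≡bⱼ) p≡v)

    -- The edge with aⱼ = u is charged to the position of v, which touches no matching edge.
    blame : ∀ {j} → Spoilt j → Fin (k * 4)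
    blame (inj₁ (i , c , _)) = combine i c
    blame (inj₂ _)           = combine i₀ c₀

    blame-injective : ∀ {j l} (sⱼ : Spoilt j) (sₗ : Spoilt l) → blame sⱼ ≡ blame sₗ → j ≡ l
    blame-injective (inj₁ (i , c , tⱼ)) (inj₁ (i' , c' , tₗ)) eq
      with refl , refl ← combine-injective i c i' c' eq = touches-unique tⱼ tₗ
    blame-injective (inj₁ (i , c , tⱼ)) (inj₂ _) eq
      with refl , refl ← combine-injective i c i₀ c₀ eq = ⊥-elim (v-untouched tⱼ)
    blame-injective (inj₂ _) (inj₁ (i , c , tₗ)) eq
      with refl , refl ← combine-injective i c i₀ c₀ (≡-sym eq) = ⊥-elim (v-untouched tₗ)
    blame-injective {j} {l} (inj₂ aⱼ≡u) (inj₂ aₗ≡u) _ = a-inj j l (trans aⱼ≡u (≡-sym aₗ≡u))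

    two-unspoilt : 4 * k + 2 ≤ n → ∃₂ λ j l → j ≢ l × ¬ Spoilt j × ¬ Spoilt l
    two-unspoilt 4k+2≤n = two-unblamed spoilt? blame blame-injective
      (subst (λ m → 2 + m ≤ n) (*-comm 4 k) (subst (_≤ n) (+-comm (4 * k) 2) 4k+2≤n))

    module _ {j l : Fin n} (j≢l : j ≢ l) (¬sⱼ : ¬ Spoilt j) (¬sₗ : ¬ Spoilt l) where

      detour : Vector (Fin (V G)) 4
      detour = b j ∷ a j ∷ v ∷ a l ∷ []

      detour-injective : Injective detour
      detour-injective = distinct₄-injective
        (λ e → a≢b j j (≡-sym e)) (proj₂ (a,b≢v j)) (λ e → a≢b l j (≡-sym e))
        (proj₁ (a,b≢v j)) (j≢l ∘ a-inj j l) (proj₁ (a,b≢v l) ∘ ≡-sym)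

      detour-meets-only-i₀ : ∀ c i c' → detour c ≡ p i c' → i ≡ i₀
      detour-meets-only-i₀ zero i c' e = ⊥-elim (¬sⱼ (inj₁ (i , c' , inj₂ (≡-sym e))))
      detour-meets-only-i₀ (suc zero) i c' e = ⊥-elim (¬sⱼ (inj₁ (i , c' , inj₁ (≡-sym e))))
      detour-meets-only-i₀ (suc (suc zero)) i c' e =
        proj₁ (p-disj i i₀ c' c₀ (trans (≡-sym e) (≡-sym p≡v)))
      detour-meets-only-i₀ (suc (suc (suc zero))) i c' e =
        ⊥-elim (¬sₗ (inj₁ (i , c' , inj₁ (≡-sym e))))

      detour-isP3 : IsP3 (deleteEdge G v u) detour
      detour-isP3 =
        deleteEdge-avoiding G v u (sym G (ab-adj j)) (proj₂ (a,b≢v j)) (proj₁ (a,b≢v j)) ,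
        deleteEdge-keeps G v u (sym G (va-adj j)) (proj₁ (a,b≢v j)) (¬sⱼ ∘ inj₂) ,
        sym (deleteEdge G v u)
            (deleteEdge-keeps G v u (sym G (va-adj l)) (proj₁ (a,b≢v l)) (¬sₗ ∘ inj₂))

    others-avoid-v : ∀ i → i ≢ i₀ → ∀ c → p i c ≢ v
    others-avoid-v i i≢i₀ c e = i≢i₀ (proj₁ (p-disj i i₀ c c₀ (trans e (≡-sym p≡v))))

    rerouted : 4 * k + 2 ≤ n → (∀ i → IsP3 G (p i)) → HasDisjointP3s (deleteEdge G v u) k
    rerouted 4k+2≤n p-paths with two-unspoilt 4k+2≤n
    ... | j , l , j≢l , ¬sⱼ , ¬sₗ =
      p [ i₀ ]≔ detour j≢l ¬sⱼ ¬sₗ ,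
      ≔-disjoint p-disj (detour-injective j≢l ¬sⱼ ¬sₗ) (detour-meets-only-i₀ j≢l ¬sⱼ ¬sₗ) ,
      ≔-isP3 {G = deleteEdge G v u}
        (λ i i≢i₀ → isP3-deleteEdge G v u (p-paths i) (others-avoid-v i i≢i₀))
        (detour-isP3 j≢l ¬sⱼ ¬sₗ)

  survives-deleteEdge : 4 * k + 2 ≤ n → (∀ i → IsP3 G (p i)) →
                        HasDisjointP3s (deleteEdge G v u) k
  survives-deleteEdge 4k+2≤n p-paths with any? (λ i → any? (λ c → p i c ≟ v))
  ... | yes (i₀ , c₀ , p≡v) = rerouted p≡v 4k+2≤n p-paths
  ... | no  v∉p =
    p , p-disj , λ i → isP3-deleteEdge G v u (p-paths i) (λ c e → v∉p (i , c , e))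

lemma18 : (G : Graph) (k : ℕ) → 1 ≤ k → (v : Fin (V G)) (n : ℕ) → 4 * k + 2 ≤ n →
    NeighbourMatching G v n →
    ∀ (u : Fin (V G)) → Adj G v u →
    HasDisjointP3s G k ⇔ HasDisjointP3s (deleteEdge G v u) k
lemma18 G k _ v n 4k+2≤n (a , b , a-inj , b-inj , a≢b , a,b≢v , ab-adj , va-adj) u _ = mk⇔
  (λ (p , p-disj , p-paths) →
     survives-deleteEdge {G = G} {u = u} a-inj b-inj a≢b a,b≢v ab-adj va-adj {p = p} p-disj
       4k+2≤n p-paths)
  (λ (p , p-disj , p-paths) → p , p-disj , λ i → isP3-deleteEdge⁻ G v u {p i} (p-paths i))
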